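{- Let $m$ be a positive integer and $\lambda$ a nonzero real number. For every $n\ge0$, $$m^{n}\,\mathrm{Bel}_{n,\lambda/m}\!\left(\frac{x}{m}\right)=\sum_{k=0}^{n}\binom{n}{k}(-1)^{n-k}\langle 1\rangle_{n-k,\lambda}\,D_{m,\lambda}(k,x).$$
   Context: For a nonzero real $\mu$: $(x)_{0,\mu}=1$, $(x)_{n,\mu}=x(x-\mu)\cdots(x-(n-1)\mu)$; $\langle x\rangle_{0,\mu}=1$, $\langle x\rangle_{n,\mu}=x(x+\mu)\cdots(x+(n-1)\mu)$; $(x)_n=(x)_{n,1}$. Degenerate Stirling numbers of the second kind: $(x)_{n,\mu}=\sum_{k=0}^{n}S_{2,\mu}(n,k)(x)_{k}$; degenerate Bell polynomials $\mathrm{Bel}_{n,\mu}(x)=\sum_{k=0}^{n}S_{2,\mu}(n,k)x^{k}$. Degenerate Whitney numbers of the second kind $W_{m,\lambda}(n,k)$: $(mx+1)_{n,\lambda}=\sum_{k=0}^{n}W_{m,\lambda}(n,k)m^{k}(x)_{k}$; degenerate Dowling polynomials $D_{m,\lambda}(n,x)=\sum_{k=0}^{n}W_{m,\lambda}(n,k)x^{k}$. -}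

module Defs where

open import Level using (Level; suc; _⊔_)
open import Data.Nat as ℕ using (ℕ; zero; _∸_; NonZero)
import Data.Nat as N
open import Data.Nat.Combinatorics using (_C_)
open import Relation.Nullary using (¬_)
open import Algebra.Bundles using (CommutativeRing)

castR : ∀ {c ℓ} (R : CommutativeRing c ℓ) → ℕ → CommutativeRing.Carrier R
castR R zero      = CommutativeRing.0# R
castR R (N.suc n) = CommutativeRing._+_ R (CommutativeRing.1# R) (castR R n)

-- A field of characteristic zero (ℝ is one), with setoid equality _≈_.
record Char0Field (c ℓ : Level) : Set (suc (c ⊔ ℓ)) where
  field
    commutativeRing : CommutativeRing c ℓ
  private module R = CommutativeRing commutativeRing
  open R using (Carrier; _≈_; 0#; 1#; _*_)
  field
    _⁻¹     : (a : Carrier) → ¬ (a ≈ 0#) → Carrier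
    ⁻¹-inverse : ∀ a (a≉0 : ¬ (a ≈ 0#)) → a * (a ⁻¹) a≉0 ≈ 1#
    char0   : ∀ n → ¬ (castR commutativeRing (N.suc n) ≈ 0#)
  open R public hiding (Carrier; _≈_; 0#; 1#; _*_)
  open R public using (Carrier; _≈_; 0#; 1#; _*_)
  cast : ℕ → Carrier
  cast = castR commutativeRing

module Ops {c ℓ : Level} (F : Char0Field c ℓ) where
  open Char0Field F

  pow : Carrier → ℕ → Carrier
  pow x zero      = 1#
  pow x (N.suc n) = pow x n * x

  cast-nonzero : ∀ m → .{{NonZero m}} → ¬ (cast m ≈ 0#)
  cast-nonzero (N.suc m) = char0 m

  divℕ : Carrier → (m : ℕ) → .{{NonZero m}} → Carrier
  divℕ a m = a * (cast m ⁻¹) (cast-nonzero m)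

  fall : Carrier → Carrier → ℕ → Carrier
  fall μ x zero      = 1#
  fall μ x (N.suc n) = fall μ x n * (x - cast n * μ)

  rise : Carrier → Carrier → ℕ → Carrier
  rise μ x zero      = 1#
  rise μ x (N.suc n) = rise μ x n * (x + cast n * μ)

  sumTo : ℕ → (ℕ → Carrier) → Carrier
  sumTo zero      f = f 0
  sumTo (N.suc n) f = sumTo n f + f (N.suc n)

  IsDegStirling2 : Carrier → (ℕ → ℕ → Carrier) → Set (c ⊔ ℓ)
  IsDegStirling2 μ S = ∀ n x → fall μ x n ≈ sumTo n (λ k → S n k * fall 1# x k)

  IsDegWhitney2 : ℕ → Carrier → (ℕ → ℕ → Carrier) → Set (c ⊔ ℓ)
  IsDegWhitney2 m λ' W = ∀ n x →
    fall λ' (cast m * x + 1#) n ≈ sumTo n (λ k → W n k * pow (cast m) k * fall 1# x k)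

  Bel : (ℕ → ℕ → Carrier) → ℕ → Carrier → Carrier
  Bel S n x = sumTo n (λ k → S n k * pow x k)

  Dow : (ℕ → ℕ → Carrier) → ℕ → Carrier → Carrier
  Dow W n x = sumTo n (λ k → W n k * pow x k)

-- Write m y = (m y + 1) + (-1). The degenerate binomial theorem, the identity
-- (-1)_{s,λ} = (-1)^s ⟨1⟩_{s,λ} and the Whitney expansion of each (m y + 1)_{k,λ} express
-- (m y)_{n,λ} = m^n (y)_{n,λ/m} in the basis of falling factorials (y)_i with coefficients
-- m^i c_i, where c_i = Σ_{i≤k≤n} C(n,k) (-1)_{n-k,λ} W_{m,λ}(k,i). The Stirling expansion gives
-- the coefficients m^n S_{2,λ/m}(n,i), and the (y)_i are linearly independent in
-- characteristic 0 (evaluate at y = 0, 1, …, n), so m^n S_{2,λ/m}(n,i) = m^i c_i.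
-- Substituted into m^n Bel_{n,λ/m}(x/m), the powers of m cancel, leaving Σ_i c_i x^i,
-- which is the right-hand side regrouped.

module Submission where

open import Defs
open import Level using (Level)
open import Data.Nat as ℕ using (ℕ; zero; suc; z≤n; s≤s; _≤?_; _∸_; NonZero)
import Data.Nat.Properties as ℕ
open import Data.Nat.Combinatorics using (_C_; k>n⇒nCk≡0; nCk+nC[k+1]≡[n+1]C[k+1])
open import Data.Nat.Induction using (<-rec)
open import Data.Integer as ℤ using (ℤ; +_; -[1+_]; _⊖_; _◃_; sign; ∣_∣)
import Data.Integer.Properties as ℤ
open import Data.Sign as Sign using (Sign)
open import Data.Maybe using (Maybe; just; nothing)
open import Data.Sum using (inj₁; inj₂)
open import Data.Empty using (⊥-elim)
open import Relation.Nullary using (¬_; yes; no)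
open import Relation.Binary.Definitions using (tri<; tri≈; tri>)
open import Relation.Binary.PropositionalEquality as ≡ using (_≢_)
open import Algebra.Bundles using (CommutativeRing)
import Algebra.Solver.Ring.AlmostCommutativeRing as ACR

module IntegerCoefficients {c ℓ : Level} (R : CommutativeRing c ℓ) where
  open CommutativeRing R
  open import Algebra.Properties.Ring ring using (-0#≈0#; -‿involutive; -‿+-comm; -1*x≈-x)
  open import Algebra.Properties.CommutativeSemigroup *-commutativeSemigroup
    using () renaming (interchange to *-interchange)
  open import Relation.Binary.Reasoning.Setoid setoid

  private
    cast : ℕ → Carrier
    cast = castR R

  cast-+ : ∀ m n → cast (m ℕ.+ n) ≈ cast m + cast n
  cast-+ zero    n = sym (+-identityˡ _)
  cast-+ (suc m) n = trans (+-congˡ (cast-+ m n)) (sym (+-assoc _ _ _))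

  cast-* : ∀ m n → cast (m ℕ.* n) ≈ cast m * cast n
  cast-* zero    n = sym (zeroˡ _)
  cast-* (suc m) n = begin
    cast (n ℕ.+ m ℕ.* n)           ≈⟨ cast-+ n (m ℕ.* n) ⟩
    cast n + cast (m ℕ.* n)        ≈⟨ +-cong (sym (*-identityˡ _)) (cast-* m n) ⟩
    1# * cast n + cast m * cast n  ≈⟨ sym (distribʳ _ _ _) ⟩
    (1# + cast m) * cast n         ∎

  -- The solver's constants con (+ 1) and :- con (+ 1) must evaluate to 1# and - 1# on
  -- the nose, so ℤ is embedded through fromℕ (1 ↦ 1#) rather than castR (1 ↦ 1# + 0#).
  fromℕ : ℕ → Carrier
  fromℕ zero          = 0#
  fromℕ (suc zero)    = 1#
  fromℕ (suc (suc n)) = 1# + fromℕ (suc n)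

  fromℕ≈cast : ∀ n → fromℕ n ≈ cast n
  fromℕ≈cast zero          = refl
  fromℕ≈cast (suc zero)    = sym (+-identityʳ 1#)
  fromℕ≈cast (suc (suc n)) = +-congˡ (fromℕ≈cast (suc n))

  fromℤ : ℤ → Carrier
  fromℤ (+ n)    = fromℕ n
  fromℤ -[1+ n ] = - fromℕ (suc n)

  private
    castℤ : ℤ → Carrier
    castℤ (+ n)    = cast n
    castℤ -[1+ n ] = - cast (suc n)

    fromℤ≈castℤ : ∀ i → fromℤ i ≈ castℤ i
    fromℤ≈castℤ (+ n)    = fromℕ≈cast n
    fromℤ≈castℤ -[1+ n ] = -‿cong (fromℕ≈cast (suc n))

    sgn : Sign → Carrier
    sgn Sign.+ = 1#
    sgn Sign.- = - 1#

    sgn-* : ∀ s t → sgn (s Sign.* t) ≈ sgn s * sgn t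
    sgn-* Sign.+ t      = sym (*-identityˡ _)
    sgn-* Sign.- Sign.+ = sym (*-identityʳ _)
    sgn-* Sign.- Sign.- = sym (trans (-1*x≈-x _) (-‿involutive 1#))

    [x+y]-[x+z]≈y-z : ∀ x y z → (x + y) - (x + z) ≈ y - z
    [x+y]-[x+z]≈y-z x y z = begin
      (x + y) + - (x + z)    ≈⟨ +-congˡ (-‿+-comm x z) ⟨
      (x + y) + (- x + - z)  ≈⟨ +-congʳ (+-comm x y) ⟩
      (y + x) + (- x + - z)  ≈⟨ +-assoc y x _ ⟩
      y + (x + (- x + - z))  ≈⟨ +-congˡ (+-assoc x (- x) _) ⟨
      y + ((x - x) + - z)    ≈⟨ +-congˡ (+-congʳ (-‿inverseʳ x)) ⟩
      y + (0# + - z)         ≈⟨ +-congˡ (+-identityˡ _) ⟩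
      y - z                  ∎

    castℤ-⊖ : ∀ m n → castℤ (m ⊖ n) ≈ cast m - cast n
    castℤ-⊖ m       zero    = sym (trans (+-congˡ -0#≈0#) (+-identityʳ _))
    castℤ-⊖ zero    (suc n) = sym (+-identityˡ _)
    castℤ-⊖ (suc m) (suc n) rewrite ℤ.[1+m]⊖[1+n]≡m⊖n m n =
      trans (castℤ-⊖ m n) (sym ([x+y]-[x+z]≈y-z 1# (cast m) (cast n)))

    castℤ-+ : ∀ i j → castℤ (i ℤ.+ j) ≈ castℤ i + castℤ j
    castℤ-+ (+ m)    (+ n)    = cast-+ m n
    castℤ-+ (+ m)    -[1+ n ] = castℤ-⊖ m (suc n)
    castℤ-+ -[1+ m ] (+ n)    = trans (castℤ-⊖ n (suc m)) (+-comm _ _)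
    castℤ-+ -[1+ m ] -[1+ n ] = begin
      - cast (suc (suc (m ℕ.+ n)))     ≈⟨ -‿cong (reflexive (≡.cong (λ k → cast (suc k)) (≡.sym (ℕ.+-suc m n)))) ⟩
      - cast (suc m ℕ.+ suc n)         ≈⟨ -‿cong (cast-+ (suc m) (suc n)) ⟩
      - (cast (suc m) + cast (suc n))  ≈⟨ -‿+-comm _ _ ⟨
      - cast (suc m) + - cast (suc n)  ∎

    castℤ-◃ : ∀ s n → castℤ (s ◃ n) ≈ sgn s * cast n
    castℤ-◃ s       zero    = sym (zeroʳ _)
    castℤ-◃ Sign.+ (suc n) = sym (*-identityˡ _)
    castℤ-◃ Sign.- (suc n) = sym (-1*x≈-x _)

    castℤ-sign-abs : ∀ i → castℤ i ≈ sgn (sign i) * cast ∣ i ∣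
    castℤ-sign-abs i = trans (reflexive (≡.cong castℤ (≡.sym (ℤ.◃-inverse i)))) (castℤ-◃ (sign i) ∣ i ∣)

    castℤ-* : ∀ i j → castℤ (i ℤ.* j) ≈ castℤ i * castℤ j
    castℤ-* i j = begin
      castℤ ((sign i Sign.* sign j) ◃ (∣ i ∣ ℕ.* ∣ j ∣))
        ≈⟨ castℤ-◃ (sign i Sign.* sign j) (∣ i ∣ ℕ.* ∣ j ∣) ⟩
      sgn (sign i Sign.* sign j) * cast (∣ i ∣ ℕ.* ∣ j ∣)
        ≈⟨ *-cong (sgn-* (sign i) (sign j)) (cast-* ∣ i ∣ ∣ j ∣) ⟩
      (sgn (sign i) * sgn (sign j)) * (cast ∣ i ∣ * cast ∣ j ∣)
        ≈⟨ *-interchange _ _ _ _ ⟩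
      (sgn (sign i) * cast ∣ i ∣) * (sgn (sign j) * cast ∣ j ∣)
        ≈⟨ *-cong (castℤ-sign-abs i) (castℤ-sign-abs j) ⟨
      castℤ i * castℤ j ∎

    castℤ-neg : ∀ i → castℤ (ℤ.- i) ≈ - castℤ i
    castℤ-neg (+ zero)  = sym -0#≈0#
    castℤ-neg (+ suc n) = refl
    castℤ-neg -[1+ n ]  = sym (-‿involutive _)

  morphism : ℤ.+-*-rawRing ACR.-Raw-AlmostCommutative⟶ ACR.fromCommutativeRing R
  morphism = record
    { ⟦_⟧    = fromℤ
    ; +-homo = λ i j → via₂ +-cong i j (i ℤ.+ j) (castℤ-+ i j)
    ; *-homo = λ i j → via₂ *-cong i j (i ℤ.* j) (castℤ-* i j)
    ; -‿homo = λ i → trans (fromℤ≈castℤ (ℤ.- i)) (trans (castℤ-neg i) (-‿cong (sym (fromℤ≈castℤ i))))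
    ; 0-homo = refl
    ; 1-homo = refl
    }
    where
    via₂ : ∀ {_∙_ : Carrier → Carrier → Carrier} → (∀ {a b a′ b′} → a ≈ a′ → b ≈ b′ → (a ∙ b) ≈ (a′ ∙ b′)) →
           ∀ i j k → castℤ k ≈ castℤ i ∙ castℤ j → fromℤ k ≈ fromℤ i ∙ fromℤ j
    via₂ ∙-cong i j k eq = trans (fromℤ≈castℤ k) (trans eq (sym (∙-cong (fromℤ≈castℤ i) (fromℤ≈castℤ j))))

  private
    coefficient-equality? : ∀ i j → Maybe (fromℤ i ≈ fromℤ j)
    coefficient-equality? i j with i ℤ.≟ j
    ... | yes ≡.refl = just refl
    ... | no _       = nothing

  open import Algebra.Solver.Ring ℤ.+-*-rawRing (ACR.fromCommutativeRing R) morphism coefficient-equality? public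
    using (solve; _:=_; _:+_; _:*_; _:-_; :-_; con)

module Sums {c ℓ : Level} (F : Char0Field c ℓ) where
  open Char0Field F
  open Ops F
  open import Relation.Binary.Reasoning.Setoid setoid
  open import Algebra.Properties.CommutativeSemigroup +-commutativeSemigroup
    using () renaming (interchange to +-interchange)

  sumTo-cong : ∀ n {f g : ℕ → Carrier} → (∀ i → i ℕ.≤ n → f i ≈ g i) → sumTo n f ≈ sumTo n g
  sumTo-cong zero    f≈g = f≈g 0 z≤n
  sumTo-cong (suc n) f≈g = +-cong (sumTo-cong n (λ i i≤n → f≈g i (ℕ.m≤n⇒m≤1+n i≤n))) (f≈g (suc n) ℕ.≤-refl)

  sumTo-+ : ∀ n (f g : ℕ → Carrier) → sumTo n (λ i → f i + g i) ≈ sumTo n f + sumTo n g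
  sumTo-+ zero    f g = refl
  sumTo-+ (suc n) f g = trans (+-congʳ (sumTo-+ n f g)) (+-interchange _ _ _ _)

  *-distribˡ-sumTo : ∀ n a (f : ℕ → Carrier) → a * sumTo n f ≈ sumTo n (λ i → a * f i)
  *-distribˡ-sumTo zero    a f = refl
  *-distribˡ-sumTo (suc n) a f = trans (distribˡ _ _ _) (+-congʳ (*-distribˡ-sumTo n a f))

  *-distribʳ-sumTo : ∀ n a (f : ℕ → Carrier) → sumTo n f * a ≈ sumTo n (λ i → f i * a)
  *-distribʳ-sumTo zero    a f = refl
  *-distribʳ-sumTo (suc n) a f = trans (distribʳ _ _ _) (+-congʳ (*-distribʳ-sumTo n a f))

  sumTo-zero : ∀ n {f : ℕ → Carrier} → (∀ i → i ℕ.≤ n → f i ≈ 0#) → sumTo n f ≈ 0#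
  sumTo-zero zero    f≈0 = f≈0 0 z≤n
  sumTo-zero (suc n) f≈0 = trans (+-cong (sumTo-zero n (λ i i≤n → f≈0 i (ℕ.m≤n⇒m≤1+n i≤n)))
                                         (f≈0 (suc n) ℕ.≤-refl))
                                 (+-identityʳ 0#)

  sumTo-single : ∀ n {j} {f : ℕ → Carrier} → j ℕ.≤ n →
                 (∀ i → i ℕ.≤ n → i ≢ j → f i ≈ 0#) → sumTo n f ≈ f j
  sumTo-single zero    z≤n _   = refl
  sumTo-single (suc n) j≤1+n f≈0 with ℕ.m≤n⇒m<n∨m≡n j≤1+n
  ... | inj₁ (s≤s j≤n) =
    trans (+-cong (sumTo-single n j≤n (λ i i≤n → f≈0 i (ℕ.m≤n⇒m≤1+n i≤n)))
                  (f≈0 (suc n) ℕ.≤-refl (λ { ≡.refl → ℕ.<-irrefl ≡.refl (s≤s j≤n) })))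
          (+-identityʳ _)
  ... | inj₂ ≡.refl =
    trans (+-congʳ (sumTo-zero n (λ i i≤n → f≈0 i (ℕ.m≤n⇒m≤1+n i≤n) (λ { ≡.refl → ℕ.<-irrefl ≡.refl (s≤s i≤n) }))))
          (+-identityˡ _)

  sumTo-comm : ∀ a b (g : ℕ → ℕ → Carrier) →
               sumTo a (λ k → sumTo b (g k)) ≈ sumTo b (λ i → sumTo a (λ k → g k i))
  sumTo-comm zero    b g = refl
  sumTo-comm (suc a) b g = trans (+-congʳ (sumTo-comm a b g)) (sym (sumTo-+ b _ _))

  sumTo-suc : ∀ n (f : ℕ → Carrier) → sumTo (suc n) f ≈ f 0 + sumTo n (λ k → f (suc k))
  sumTo-suc zero    f = refl
  sumTo-suc (suc n) f = trans (+-congʳ (sumTo-suc n f)) (+-assoc _ _ _)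

  sumTo-truncate : ∀ {n k} {f : ℕ → Carrier} → k ℕ.≤ n → (∀ i → k ℕ.< i → f i ≈ 0#) →
                   sumTo n f ≈ sumTo k f
  sumTo-truncate {zero}  z≤n    _   = refl
  sumTo-truncate {suc n} k≤1+n f≈0 with ℕ.m≤n⇒m<n∨m≡n k≤1+n
  ... | inj₁ (s≤s k≤n) = trans (+-cong (sumTo-truncate k≤n f≈0) (f≈0 (suc n) (s≤s k≤n))) (+-identityʳ _)
  ... | inj₂ ≡.refl    = refl

  triangle : (ℕ → ℕ → Carrier) → ℕ → ℕ → Carrier
  triangle T k i with i ≤? k
  ... | yes _ = T k i
  ... | no  _ = 0#

  triangle-≤ : ∀ T {k i} → i ℕ.≤ k → triangle T k i ≈ T k i
  triangle-≤ T {k} {i} i≤k with i ≤? k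
  ... | yes _   = refl
  ... | no  i≰k = ⊥-elim (i≰k i≤k)

  triangle-> : ∀ T {k i} → k ℕ.< i → triangle T k i ≈ 0#
  triangle-> T {k} {i} k<i with i ≤? k
  ... | yes i≤k = ⊥-elim (ℕ.<⇒≱ k<i i≤k)
  ... | no  _   = refl

  triangle-*ʳ : ∀ T (u : ℕ → Carrier) k i → triangle (λ k i → T k i * u i) k i ≈ triangle T k i * u i
  triangle-*ʳ T u k i with i ≤? k
  ... | yes _ = refl
  ... | no  _ = sym (zeroˡ (u i))

  sumTo-triangle : ∀ n (T : ℕ → ℕ → Carrier) (u : ℕ → Carrier) →
                   sumTo n (λ k → sumTo k (λ i → T k i * u i))
                   ≈ sumTo n (λ i → sumTo n (λ k → triangle T k i) * u i)
  sumTo-triangle n T u = begin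
    sumTo n (λ k → sumTo k (λ i → T k i * u i))
      ≈⟨ sumTo-cong n (λ k k≤n → sym (trans (sumTo-truncate k≤n (λ i → triangle-> Tu))
                                           (sumTo-cong k (λ i → triangle-≤ Tu)))) ⟩
    sumTo n (λ k → sumTo n (λ i → triangle Tu k i))        ≈⟨ sumTo-comm n n _ ⟩
    sumTo n (λ i → sumTo n (λ k → triangle Tu k i))
      ≈⟨ sumTo-cong n (λ i _ → sumTo-cong n (λ k _ → triangle-*ʳ T u k i)) ⟩
    sumTo n (λ i → sumTo n (λ k → triangle T k i * u i))   ≈⟨ sumTo-cong n (λ i _ → *-distribʳ-sumTo n (u i) _) ⟨
    sumTo n (λ i → sumTo n (λ k → triangle T k i) * u i)   ∎
    where
    Tu : ℕ → ℕ → Carrier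
    Tu k i = T k i * u i

module FallingFactorials {c ℓ : Level} (F : Char0Field c ℓ) where
  open Char0Field F
  open Ops F
  open Sums F
  open IntegerCoefficients commutativeRing using (cast-+; solve; _:=_; _:+_; _:*_; _:-_; :-_; con)
  open import Algebra.Properties.Ring ring using (x∙y⁻¹≈ε⇒x≈y)
  open import Algebra.Properties.CommutativeSemigroup *-commutativeSemigroup
    using (x∙yz≈y∙xz) renaming (interchange to *-interchange)
  open import Relation.Binary.Reasoning.Setoid setoid

  x*y≈0⇒x≈0 : ∀ {x y} → ¬ y ≈ 0# → x * y ≈ 0# → x ≈ 0#
  x*y≈0⇒x≈0 {x} {y} y≉0 xy≈0 = begin
    x                    ≈⟨ *-identityʳ x ⟨
    x * 1#               ≈⟨ *-congˡ (⁻¹-inverse y y≉0) ⟨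
    x * (y * (y ⁻¹) y≉0) ≈⟨ *-assoc x y _ ⟨
    (x * y) * (y ⁻¹) y≉0 ≈⟨ *-congʳ xy≈0 ⟩
    0# * (y ⁻¹) y≉0      ≈⟨ zeroˡ _ ⟩
    0#                   ∎

  *-nonzero : ∀ {x y} → ¬ x ≈ 0# → ¬ y ≈ 0# → ¬ x * y ≈ 0#
  *-nonzero x≉0 y≉0 xy≈0 = x≉0 (x*y≈0⇒x≈0 y≉0 xy≈0)

  1#≉0# : ¬ 1# ≈ 0#
  1#≉0# 1≈0 = char0 0 (trans (+-identityʳ 1#) 1≈0)

  pow-cong : ∀ n {x y} → x ≈ y → pow x n ≈ pow y n
  pow-cong zero    x≈y = refl
  pow-cong (suc n) x≈y = *-cong (pow-cong n x≈y) x≈y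

  pow-*-distrib : ∀ x y n → pow x n * pow y n ≈ pow (x * y) n
  pow-*-distrib x y zero    = *-identityʳ 1#
  pow-*-distrib x y (suc n) = trans (*-interchange _ _ _ _) (*-congʳ (pow-*-distrib x y n))

  fall-cong : ∀ μ n {x y} → x ≈ y → fall μ x n ≈ fall μ y n
  fall-cong μ zero    x≈y = refl
  fall-cong μ (suc n) x≈y = *-cong (fall-cong μ n x≈y) (+-congʳ x≈y)

  -- The inductive step of any binomial-type theorem: only Pascal's rule is involved.
  pascal-sum : ∀ n (A B : ℕ → Carrier) →
    sumTo n (λ k → cast (n C k) * A (suc k) * B (n ∸ k)) + sumTo n (λ k → cast (n C k) * A k * B (suc n ∸ k))
    ≈ sumTo (suc n) (λ k → cast (suc n C k) * A k * B (suc n ∸ k))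
  pascal-sum n A B = begin
    sumTo n U + sumTo n V                          ≈⟨ +-congˡ V-shift ⟩
    sumTo n U + (V 0 + sumTo n (λ k → V (suc k)))  ≈⟨ x+[y+z]≈y+[x+z] _ _ _ ⟩
    V 0 + (sumTo n U + sumTo n (λ k → V (suc k)))  ≈⟨ +-congˡ (sumTo-+ n U (λ k → V (suc k))) ⟨
    V 0 + sumTo n (λ k → U k + V (suc k))          ≈⟨ +-congˡ (sumTo-cong n (λ k _ → pascal k)) ⟩
    V 0 + sumTo n (λ k → V′ (suc k))               ≈⟨ sumTo-suc n V′ ⟨
    sumTo (suc n) V′                               ∎
    where
    U V V′ : ℕ → Carrier
    U k  = cast (n C k) * A (suc k) * B (n ∸ k)
    V k  = cast (n C k) * A k * B (suc n ∸ k)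
    V′ k = cast (suc n C k) * A k * B (suc n ∸ k)
    x+[y+z]≈y+[x+z] : ∀ x y z → x + (y + z) ≈ y + (x + z)
    x+[y+z]≈y+[x+z] = solve 3 (λ x y z → x :+ (y :+ z) := y :+ (x :+ z)) refl
    V-shift : sumTo n V ≈ V 0 + sumTo n (λ k → V (suc k))
    V-shift = begin
      sumTo n V                        ≈⟨ +-identityʳ _ ⟨
      sumTo n V + 0#                   ≈⟨ +-congˡ V[1+n]≈0 ⟨
      sumTo (suc n) V                  ≈⟨ sumTo-suc n V ⟩
      V 0 + sumTo n (λ k → V (suc k))  ∎
      where
      V[1+n]≈0 : V (suc n) ≈ 0#
      V[1+n]≈0 = trans (*-congʳ (*-congʳ (reflexive (≡.cong cast (k>n⇒nCk≡0 (ℕ.n<1+n n))))))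
                       (trans (*-congʳ (zeroˡ _)) (zeroˡ _))
    pascal : ∀ k → U k + V (suc k) ≈ V′ (suc k)
    pascal k = begin
      cast (n C k) * A (suc k) * B (n ∸ k) + cast (n C suc k) * A (suc k) * B (n ∸ k)
        ≈⟨ distribʳ _ _ _ ⟨
      (cast (n C k) * A (suc k) + cast (n C suc k) * A (suc k)) * B (n ∸ k)
        ≈⟨ *-congʳ (distribʳ _ _ _) ⟨
      (cast (n C k) + cast (n C suc k)) * A (suc k) * B (n ∸ k)
        ≈⟨ *-congʳ (*-congʳ (trans (sym (cast-+ (n C k) (n C suc k)))
                                   (reflexive (≡.cong cast (nCk+nC[k+1]≡[n+1]C[k+1] n k))))) ⟩
      cast (suc n C suc k) * A (suc k) * B (n ∸ k) ∎

  fall-binomial : ∀ μ a b n →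
    fall μ (a + b) n ≈ sumTo n (λ k → cast (n C k) * fall μ a k * fall μ b (n ∸ k))
  fall-binomial μ a b zero    = sym (trans (*-identityʳ _) (trans (*-identityʳ _) (+-identityʳ 1#)))
  fall-binomial μ a b (suc n) = begin
    fall μ (a + b) n * X                    ≈⟨ *-congʳ (fall-binomial μ a b n) ⟩
    sumTo n t * X                           ≈⟨ *-distribʳ-sumTo n X t ⟩
    sumTo n (λ k → t k * X)                 ≈⟨ sumTo-cong n split ⟩
    sumTo n (λ k → U k + V k)               ≈⟨ sumTo-+ n U V ⟩
    sumTo n U + sumTo n V                   ≈⟨ pascal-sum n (fall μ a) (fall μ b) ⟩
    sumTo (suc n) (λ k → cast (suc n C k) * fall μ a k * fall μ b (suc n ∸ k)) ∎
    where
    X : Carrier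
    X = a + b - cast n * μ
    t U V : ℕ → Carrier
    t k = cast (n C k) * fall μ a k * fall μ b (n ∸ k)
    U k = cast (n C k) * fall μ a (suc k) * fall μ b (n ∸ k)
    V k = cast (n C k) * fall μ a k * fall μ b (suc n ∸ k)
    distribute : ∀ C A B a b K J μ → C * A * B * (a + b - (K + J) * μ)
                 ≈ C * (A * (a - K * μ)) * B + C * A * (B * (b - J * μ))
    distribute = solve 8 (λ C A B a b K J μ → C :* A :* B :* (a :+ b :- (K :+ J) :* μ)
                         := C :* (A :* (a :- K :* μ)) :* B :+ C :* A :* (B :* (b :- J :* μ))) refl
    split : ∀ k → k ℕ.≤ n → t k * X ≈ U k + V k
    split k k≤n = begin
      t k * X
        ≈⟨ *-congˡ (+-congˡ (-‿cong (*-congʳ (trans (reflexive (≡.cong cast (≡.sym (ℕ.m+[n∸m]≡n k≤n))))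
                                                   (cast-+ k (n ∸ k)))))) ⟩
      t k * (a + b - (cast k + cast (n ∸ k)) * μ)
        ≈⟨ distribute _ _ _ _ _ _ _ _ ⟩
      U k + cast (n C k) * fall μ a k * fall μ b (suc (n ∸ k))
        ≈⟨ +-congˡ (reflexive (≡.cong (λ j → cast (n C k) * fall μ a k * fall μ b j) (≡.sym (ℕ.+-∸-assoc 1 k≤n)))) ⟩
      U k + V k ∎

  fall-at-minus-one : ∀ μ s → fall μ (- 1#) s ≈ pow (- 1#) s * rise μ 1# s
  fall-at-minus-one μ zero    = sym (*-identityʳ 1#)
  fall-at-minus-one μ (suc s) = trans (*-congʳ (fall-at-minus-one μ s)) (regroup _ _ _ _)
    where
    regroup : ∀ p r N μ → (p * r) * (- 1# - N * μ) ≈ (p * - 1#) * (r * (1# + N * μ))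
    regroup = solve 4 (λ p r N μ → (p :* r) :* (:- con (ℤ.+ 1) :- N :* μ)
                      := (p :* (:- con (ℤ.+ 1))) :* (r :* (con (ℤ.+ 1) :+ N :* μ))) refl

  module Scaling (M M⁻¹ : Carrier) (M*M⁻¹≈1 : M * M⁻¹ ≈ 1#) where

    fall-scale : ∀ μ n y → fall μ (M * y) n ≈ pow M n * fall (μ * M⁻¹) y n
    fall-scale μ zero    y = sym (*-identityʳ 1#)
    fall-scale μ (suc n) y = begin
      fall μ (M * y) n * (M * y - cast n * μ)
        ≈⟨ *-cong (fall-scale μ n y) (+-congˡ (-‿cong (*-congˡ μ≈M[μM⁻¹]))) ⟩
      (pow M n * fall (μ * M⁻¹) y n) * (M * y - cast n * (M * (μ * M⁻¹)))
        ≈⟨ *-congˡ (factor-M _ _ _ _) ⟩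
      (pow M n * fall (μ * M⁻¹) y n) * (M * (y - cast n * (μ * M⁻¹)))
        ≈⟨ *-interchange _ _ _ _ ⟩
      (pow M n * M) * (fall (μ * M⁻¹) y n * (y - cast n * (μ * M⁻¹))) ∎
      where
      μ≈M[μM⁻¹] : μ ≈ M * (μ * M⁻¹)
      μ≈M[μM⁻¹] = begin
        μ             ≈⟨ *-identityʳ μ ⟨
        μ * 1#        ≈⟨ *-congˡ M*M⁻¹≈1 ⟨
        μ * (M * M⁻¹) ≈⟨ x∙yz≈y∙xz μ M M⁻¹ ⟩
        M * (μ * M⁻¹) ∎
      factor-M : ∀ M y N ν → M * y - N * (M * ν) ≈ M * (y - N * ν)
      factor-M = solve 4 (λ M y N ν → M :* y :- N :* (M :* ν) := M :* (y :- N :* ν)) refl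

    pow-unscale : ∀ x i → pow (x * M⁻¹) i * pow M i ≈ pow x i
    pow-unscale x i = trans (pow-*-distrib (x * M⁻¹) M i) (pow-cong i x[M⁻¹M]≈x)
      where
      x[M⁻¹M]≈x : x * M⁻¹ * M ≈ x
      x[M⁻¹M]≈x = trans (*-assoc x M⁻¹ M) (trans (*-congˡ (trans (*-comm M⁻¹ M) M*M⁻¹≈1)) (*-identityʳ x))

  fall-cast-vanishes : ∀ {j s} → j ℕ.≤ s → fall 1# (cast j) (suc s) ≈ 0#
  fall-cast-vanishes {j} {s} j≤s with ℕ.m≤n⇒m<n∨m≡n j≤s
  ... | inj₂ ≡.refl = trans (*-congˡ (x-x*1≈0 (cast j))) (zeroʳ _)
    where
    x-x*1≈0 : ∀ x → x - x * 1# ≈ 0#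
    x-x*1≈0 = solve 1 (λ x → x :- x :* con (ℤ.+ 1) := con (ℤ.+ 0)) refl
  fall-cast-vanishes {j} {suc s} _ | inj₁ (s≤s j≤s) = trans (*-congʳ (fall-cast-vanishes j≤s)) (zeroˡ _)

  fall-cast-nonzero : ∀ {j s} → s ℕ.≤ j → ¬ fall 1# (cast j) s ≈ 0#
  fall-cast-nonzero {j} {zero}  _   = 1#≉0#
  fall-cast-nonzero {j} {suc s} s<j = *-nonzero (fall-cast-nonzero (ℕ.<⇒≤ s<j)) last-factor≉0
    where
    [x+y]-y*1≈x : ∀ x y → (x + y) - y * 1# ≈ x
    [x+y]-y*1≈x = solve 2 (λ x y → (x :+ y) :- y :* con (ℤ.+ 1) := x) refl
    cast-j∸s : cast (j ∸ s) + cast s ≈ cast j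
    cast-j∸s = trans (sym (cast-+ (j ∸ s) s)) (reflexive (≡.cong cast (ℕ.m∸n+n≡m (ℕ.<⇒≤ s<j))))
    last-factor≉0 : ¬ cast j - cast s * 1# ≈ 0#
    last-factor≉0 factor≈0 = cast-nonzero (j ∸ s) {{ℕ.>-nonZero (ℕ.m<n⇒0<n∸m s<j)}} (begin
      cast (j ∸ s)                           ≈⟨ [x+y]-y*1≈x _ _ ⟨
      (cast (j ∸ s) + cast s) - cast s * 1#  ≈⟨ +-congʳ cast-j∸s ⟩
      cast j - cast s * 1#                   ≈⟨ factor≈0 ⟩
      0#                                     ∎)

  fall-independent : ∀ n {e : ℕ → Carrier} → (∀ y → sumTo n (λ i → e i * fall 1# y i) ≈ 0#) →
                     ∀ i → i ℕ.≤ n → e i ≈ 0#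
  fall-independent n {e} Σ≈0 = <-rec (λ i → i ℕ.≤ n → e i ≈ 0#) step
    where
    -- evaluating at y = j kills every term with i > j, and those with i < j vanish by induction
    step : ∀ j → (∀ {i} → i ℕ.< j → i ℕ.≤ n → e i ≈ 0#) → j ℕ.≤ n → e j ≈ 0#
    step j ih j≤n = x*y≈0⇒x≈0 (fall-cast-nonzero {j} ℕ.≤-refl)
                      (trans (sym (sumTo-single n j≤n other-terms≈0)) (Σ≈0 (cast j)))
      where
      other-terms≈0 : ∀ i → i ℕ.≤ n → i ≢ j → e i * fall 1# (cast j) i ≈ 0#
      other-terms≈0 i i≤n i≢j with ℕ.<-cmp i j
      ... | tri< i<j _ _ = trans (*-congʳ (ih i<j i≤n)) (zeroˡ _)
      ... | tri≈ _ i≡j _ = ⊥-elim (i≢j i≡j)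
      other-terms≈0 (suc s) _ _ | tri> _ _ (s≤s j≤s) = trans (*-congˡ (fall-cast-vanishes j≤s)) (zeroʳ _)

  fall-coefficients-unique : ∀ n {a b : ℕ → Carrier} →
    (∀ y → sumTo n (λ i → a i * fall 1# y i) ≈ sumTo n (λ i → b i * fall 1# y i)) →
    ∀ i → i ℕ.≤ n → a i ≈ b i
  fall-coefficients-unique n {a} {b} Σa≈Σb i i≤n =
    x∙y⁻¹≈ε⇒x≈y (a i) (b i) (fall-independent n difference≈0 i i≤n)
    where
    [x-y]z≈xz+-1yz : ∀ x y z → (x - y) * z ≈ x * z + - 1# * (y * z)
    [x-y]z≈xz+-1yz = solve 3 (λ x y z → (x :- y) :* z := x :* z :+ (:- con (ℤ.+ 1)) :* (y :* z)) refl
    x+-1x≈0 : ∀ x → x + - 1# * x ≈ 0#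
    x+-1x≈0 = solve 1 (λ x → x :+ (:- con (ℤ.+ 1)) :* x := con (ℤ.+ 0)) refl
    difference≈0 : ∀ y → sumTo n (λ i → (a i - b i) * fall 1# y i) ≈ 0#
    difference≈0 y = begin
      sumTo n (λ i → (a i - b i) * fall 1# y i)
        ≈⟨ sumTo-cong n (λ i _ → [x-y]z≈xz+-1yz (a i) (b i) (fall 1# y i)) ⟩
      sumTo n (λ i → a i * fall 1# y i + - 1# * (b i * fall 1# y i))
        ≈⟨ sumTo-+ n _ _ ⟩
      sumTo n (λ i → a i * fall 1# y i) + sumTo n (λ i → - 1# * (b i * fall 1# y i))
        ≈⟨ +-congˡ (*-distribˡ-sumTo n (- 1#) _) ⟨
      sumTo n (λ i → a i * fall 1# y i) + - 1# * sumTo n (λ i → b i * fall 1# y i)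
        ≈⟨ +-congˡ (*-congˡ (Σa≈Σb y)) ⟨
      sumTo n (λ i → a i * fall 1# y i) + - 1# * sumTo n (λ i → a i * fall 1# y i)
        ≈⟨ x+-1x≈0 _ ⟩
      0# ∎

module DowlingExpansion {c ℓ : Level} (F : Char0Field c ℓ) (m : ℕ) .{{_ : NonZero m}}
                        (λ' : Char0Field.Carrier F) (W : ℕ → ℕ → Char0Field.Carrier F) (n : ℕ) where
  open Char0Field F
  open Ops F
  open Sums F
  open FallingFactorials F
  open IntegerCoefficients commutativeRing using (solve; _:=_; _:+_; _:*_; :-_; con)
  open import Relation.Binary.Reasoning.Setoid setoid

  M M⁻¹ : Carrier
  M   = cast m
  M⁻¹ = (M ⁻¹) (cast-nonzero m)

  open Scaling M M⁻¹ (⁻¹-inverse M (cast-nonzero m)) public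

  term : ℕ → ℕ → Carrier
  term k i = cast (n C k) * fall λ' (- 1#) (n ∸ k) * W k i

  -- IsDegWhitney2 constrains W k i only for i ≤ k, hence the triangle.
  coeff : ℕ → Carrier
  coeff i = sumTo n (λ k → triangle term k i)

  expand-term : ∀ k (u : ℕ → Carrier) →
    cast (n C k) * fall λ' (- 1#) (n ∸ k) * sumTo k (λ i → W k i * u i) ≈ sumTo k (λ i → term k i * u i)
  expand-term k u = trans (*-distribˡ-sumTo k _ _) (sumTo-cong k (λ i _ → sym (*-assoc _ _ _)))

  dowling-sum-coefficients : ∀ x →
    sumTo n (λ k → cast (n C k) * pow (- 1#) (n ∸ k) * rise λ' 1# (n ∸ k) * Dow W k x)
    ≈ sumTo n (λ i → coeff i * pow x i)
  dowling-sum-coefficients x = begin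
    sumTo n (λ k → cast (n C k) * pow (- 1#) (n ∸ k) * rise λ' 1# (n ∸ k) * Dow W k x)
      ≈⟨ sumTo-cong n (λ k _ → *-congʳ (trans (*-assoc _ _ _) (*-congˡ (sym (fall-at-minus-one λ' (n ∸ k)))))) ⟩
    sumTo n (λ k → cast (n C k) * fall λ' (- 1#) (n ∸ k) * Dow W k x)
      ≈⟨ sumTo-cong n (λ k _ → expand-term k (pow x)) ⟩
    sumTo n (λ k → sumTo k (λ i → term k i * pow x i))
      ≈⟨ sumTo-triangle n term (pow x) ⟩
    sumTo n (λ i → coeff i * pow x i) ∎

  scaled-fall-coefficients : IsDegWhitney2 m λ' W → ∀ y →
    fall λ' (M * y) n ≈ sumTo n (λ i → coeff i * (pow M i * fall 1# y i))
  scaled-fall-coefficients whitney y = begin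
    fall λ' (M * y) n
      ≈⟨ fall-cong λ' n ([x+1]-1≈x (M * y)) ⟨
    fall λ' ((M * y + 1#) + - 1#) n
      ≈⟨ fall-binomial λ' _ _ n ⟩
    sumTo n (λ k → cast (n C k) * fall λ' (M * y + 1#) k * fall λ' (- 1#) (n ∸ k))
      ≈⟨ sumTo-cong n (λ k _ → x*y*z≈x*z*y _ _ _) ⟩
    sumTo n (λ k → cast (n C k) * fall λ' (- 1#) (n ∸ k) * fall λ' (M * y + 1#) k)
      ≈⟨ sumTo-cong n (λ k _ → *-congˡ (trans (whitney k y) (sumTo-cong k (λ i _ → *-assoc _ _ _)))) ⟩
    sumTo n (λ k → cast (n C k) * fall λ' (- 1#) (n ∸ k) * sumTo k (λ i → W k i * (pow M i * fall 1# y i)))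
      ≈⟨ sumTo-cong n (λ k _ → expand-term k _) ⟩
    sumTo n (λ k → sumTo k (λ i → term k i * (pow M i * fall 1# y i)))
      ≈⟨ sumTo-triangle n term _ ⟩
    sumTo n (λ i → coeff i * (pow M i * fall 1# y i)) ∎
    where
    [x+1]-1≈x : ∀ x → (x + 1#) + - 1# ≈ x
    [x+1]-1≈x = solve 1 (λ x → (x :+ con (ℤ.+ 1)) :+ (:- con (ℤ.+ 1)) := x) refl
    x*y*z≈x*z*y : ∀ x y z → x * y * z ≈ x * z * y
    x*y*z≈x*z*y = solve 3 (λ x y z → x :* y :* z := x :* z :* y) refl

  coeff≈scaled-stirling : (S : ℕ → ℕ → Carrier) → IsDegStirling2 (divℕ λ' m) S → IsDegWhitney2 m λ' W →
    ∀ i → i ℕ.≤ n → coeff i * pow M i ≈ pow M n * S n i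
  coeff≈scaled-stirling S stirling whitney = fall-coefficients-unique n λ y → begin
    sumTo n (λ i → (coeff i * pow M i) * fall 1# y i)     ≈⟨ sumTo-cong n (λ i _ → *-assoc _ _ _) ⟩
    sumTo n (λ i → coeff i * (pow M i * fall 1# y i))     ≈⟨ scaled-fall-coefficients whitney y ⟨
    fall λ' (M * y) n                                     ≈⟨ fall-scale λ' n y ⟩
    pow M n * fall (divℕ λ' m) y n                        ≈⟨ *-congˡ (stirling n y) ⟩
    pow M n * sumTo n (λ i → S n i * fall 1# y i)         ≈⟨ *-distribˡ-sumTo n _ _ ⟩
    sumTo n (λ i → pow M n * (S n i * fall 1# y i))       ≈⟨ sumTo-cong n (λ i _ → *-assoc _ _ _) ⟨
    sumTo n (λ i → (pow M n * S n i) * fall 1# y i)       ∎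

theorem26 : ∀ {c ℓ : Level} (F : Char0Field c ℓ) →
    let open Char0Field F
        open Ops F
    in (m : ℕ) → .{{_ : NonZero m}} → (λ' : Carrier) → ¬ (λ' ≈ 0#) →
       (S : ℕ → ℕ → Carrier) → IsDegStirling2 (divℕ λ' m) S →
       (W : ℕ → ℕ → Carrier) → IsDegWhitney2 m λ' W →
       ∀ (n : ℕ) (x : Carrier) →
         pow (cast m) n * Bel S n (divℕ x m)
           ≈ sumTo n (λ k → cast (n C k) * pow (- 1#) (n ∸ k) * rise λ' 1# (n ∸ k) * Dow W k x)
theorem26 F m λ' _ S stirling W whitney n x = begin
  pow M n * sumTo n (λ i → S n i * pow (x * M⁻¹) i)      ≈⟨ *-distribˡ-sumTo n _ _ ⟩
  sumTo n (λ i → pow M n * (S n i * pow (x * M⁻¹) i))    ≈⟨ sumTo-cong n (λ i _ → *-assoc _ _ _) ⟨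
  sumTo n (λ i → (pow M n * S n i) * pow (x * M⁻¹) i)
    ≈⟨ sumTo-cong n (λ i i≤n → *-congʳ (coeff≈scaled-stirling S stirling whitney i i≤n)) ⟨
  sumTo n (λ i → (coeff i * pow M i) * pow (x * M⁻¹) i)
    ≈⟨ sumTo-cong n (λ i _ → trans (*-assoc _ _ _) (*-congˡ (trans (*-comm _ _) (pow-unscale x i)))) ⟩
  sumTo n (λ i → coeff i * pow x i)                      ≈⟨ dowling-sum-coefficients x ⟨
  sumTo n (λ k → cast (n C k) * pow (- 1#) (n ∸ k) * rise λ' 1# (n ∸ k) * Dow W k x) ∎
  where
  open Char0Field F
  open Ops F
  open Sums F
  open DowlingExpansion F m λ' W n
  open import Relation.Binary.Reasoning.Setoid setoid
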